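{- Let $a,m\in\mathbb{N}$ and $k,d\in\mathbb{N}\cup\{0\}$ with $a+kd\le m$, and let $l$ be an integer with $l\ge m$. Define $$I=[a-1]\cup\{\,i\in[l]\setminus\{a+jd:0\le j\le k\}\;:\; \text{for all } 0\le j\le k,\ a+jd<i \Rightarrow l-i<m-(a+jd)\,\}.$$ Then $$|I|=m-kd-1+k\cdot\max(0,\,d-l+m-1).$$ In particular $|I|$ does not depend on $a$, only on $m,k,d,l$.
   Context: $[n]=\{1,\dots,n\}$ for a nonnegative integer $n$, with $[0]=\emptyset$. -}

module Defs where

open import Data.Nat using (ℕ; zero; suc; z≤n; _+_; _*_; _∸_; _≤_; _<_; _≤?_; _<?_; _≟_)
open import Data.Nat.Properties using (m≤n⇒m≤1+n; ≤-refl; m≤n⇒m<n∨m≡n; ≤-pred)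
open import Relation.Binary.PropositionalEquality using (_≡_; refl)
open import Data.List using (List; []; _∷_; filter; length; map)
open import Data.List.Base using (upTo)
open import Data.Product using (_×_; _,_; Σ)
open import Data.Sum using (_⊎_; inj₁; inj₂)
open import Relation.Nullary using (¬_; Dec; yes; no)
open import Relation.Nullary.Decidable using (_⊎-dec_; _×-dec_; ¬?; _→-dec_)
open import Relation.Unary using (Pred; Decidable)

range : ℕ → List ℕ
range n = map suc (upTo n)

All≤ : ℕ → (ℕ → Set) → Set
All≤ k P = (j : ℕ) → j ≤ k → P j

all≤? : (k : ℕ) (P : ℕ → Set) → ((j : ℕ) → Dec (P j)) → Dec (All≤ k P)
all≤? zero P dec with dec zero
... | yes p = yes λ { zero _ → p ; (suc j) () }
... | no ¬p = no λ h → ¬p (h zero z≤n)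
all≤? (suc k) P dec with all≤? k P dec | dec (suc k)
... | no ¬h | _ = no λ h → ¬h (λ j j≤k → h j (m≤n⇒m≤1+n j≤k))
... | yes h | no ¬p = no λ h' → ¬p (h' (suc k) ≤-refl)
... | yes h | yes p = yes λ j j≤sk → helper j j≤sk
  where
  helper : (j : ℕ) → j ≤ suc k → P j
  helper j j≤sk with m≤n⇒m<n∨m≡n j≤sk
  ... | inj₁ j<sk = h j (≤-pred j<sk)
  ... | inj₂ refl = p

InI : (a m k d l : ℕ) → ℕ → Set
InI a m k d l i =
  (1 ≤ i × i ≤ a ∸ 1)
  ⊎ ((All≤ k λ j → ¬ (i ≡ a + j * d))
     × (All≤ k λ j → a + j * d < i → l ∸ i < m ∸ (a + j * d)))

InI? : (a m k d l : ℕ) → Decidable (InI a m k d l)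
InI? a m k d l i =
  ((1 ≤? i) ×-dec (i ≤? a ∸ 1))
  ⊎-dec ((all≤? k _ (λ j → ¬? (i ≟ a + j * d)))
         ×-dec (all≤? k _ (λ j → (a + j * d <? i) →-dec (l ∸ i <? m ∸ (a + j * d)))))

-- I as a list of its elements (I ⊆ [l] since a - 1 < m ≤ l)
Iset : (a m k d l : ℕ) → List ℕ
Iset a m k d l = filter (InI? a m k d l) (range l)

cardI : (a m k d l : ℕ) → ℕ
cardI a m k d l = length (Iset a m k d l)

-- Write l = m + s. For a point a + jd below i, the condition l - i < m - (a + jd) says
-- i > a + jd + s: each excluded point casts a shadow over the next s integers, and the
-- condition coming from the largest excluded point below i implies all the others.
-- So [l] splits into [a - 1], entirely in I; k gaps of length d between consecutive
-- excluded points, each contributing max(0, d - s - 1); and the stretch from a + kd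
-- to l, of which exactly the last m - a - kd integers lie in I.
module Submission where

open import Defs
open import Data.Nat using (ℕ; _+_; _*_; _≤_; _<_)
open import Data.Integer using (ℤ; +_; _-_; _⊔_)
open import Relation.Binary.PropositionalEquality using (_≡_)

open import Level using (Level)
open import Data.Nat using (zero; suc; _∸_; z≤n; s≤s; _≤?_)
open import Data.Nat.Properties
open import Data.Nat.Tactic.RingSolver as ℕ-Solver using ()
import Data.Integer as ℤ
import Data.Integer.Properties as ℤₚ
open import Data.Integer.Tactic.RingSolver as ℤ-Solver using ()
open import Data.List using (filter; length; applyUpTo)
open import Data.List.Properties using (map-upTo)
open import Data.Product using (_×_; _,_)
open import Data.Sum using (inj₁; inj₂)
open import Function using (_∘_; _⇔_; mk⇔; Equivalence)
open import Relation.Binary.PropositionalEquality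
  using (refl; sym; trans; cong; cong₂; subst; subst₂; module ≡-Reasoning)
open import Relation.Nullary using (¬_; yes; no; contradiction)
open import Relation.Unary using (Pred; Decidable)

open ≡-Reasoning

module Counting {ℓ : Level} {P : Pred ℕ ℓ} (P? : Decidable P) where

  countFrom : ℕ → ℕ → ℕ
  countFrom lo zero = 0
  countFrom lo (suc n) with P? lo
  ... | yes _ = suc (countFrom (suc lo) n)
  ... | no _ = countFrom (suc lo) n

  private
    <-shift : ∀ {i lo n} → i < suc lo + n → i < lo + suc n
    <-shift {i} {lo} {n} = subst (i <_) (sym (+-suc lo n))

    ≤-shift : ∀ {i lo n} → suc lo + n ≤ i → lo + suc n ≤ i
    ≤-shift {i} {lo} {n} = subst (_≤ i) (sym (+-suc lo n))

  countFrom-+ : ∀ lo n₁ n₂ → countFrom lo (n₁ + n₂) ≡ countFrom lo n₁ + countFrom (lo + n₁) n₂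
  countFrom-+ lo zero n₂ = cong (λ lo′ → countFrom lo′ n₂) (sym (+-identityʳ lo))
  countFrom-+ lo (suc n₁) n₂ rewrite +-suc lo n₁ with P? lo
  ... | yes _ = cong suc (countFrom-+ (suc lo) n₁ n₂)
  ... | no _ = countFrom-+ (suc lo) n₁ n₂

  countFrom-all : ∀ lo n → (∀ {i} → lo ≤ i → i < lo + n → P i) → countFrom lo n ≡ n
  countFrom-all lo zero _ = refl
  countFrom-all lo (suc n) all with P? lo
  ... | yes _ = cong suc (countFrom-all (suc lo) n λ lo<i i< → all (<⇒≤ lo<i) (<-shift i<))
  ... | no ¬p = contradiction (all ≤-refl (<-shift (s≤s (m≤m+n lo n)))) ¬p

  countFrom-threshold : ∀ lo c n →
    (∀ {i} → lo ≤ i → i < lo + c → ¬ P i) →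
    (∀ {i} → lo + c ≤ i → i < lo + n → P i) →
    countFrom lo n ≡ n ∸ c
  countFrom-threshold lo zero n _ all =
    countFrom-all lo n λ lo≤i → all (subst (_≤ _) (sym (+-identityʳ lo)) lo≤i)
  countFrom-threshold lo (suc c) zero _ _ = refl
  countFrom-threshold lo (suc c) (suc n) none all with P? lo
  ... | yes p = contradiction p (none ≤-refl (<-shift (s≤s (m≤m+n lo c))))
  ... | no _ = countFrom-threshold (suc lo) c n
    (λ lo<i i< → none (<⇒≤ lo<i) (<-shift i<))
    (λ ≤i i< → all (≤-shift ≤i) (<-shift i<))

  length-filter-applyUpTo : ∀ n {lo} (f : ℕ → ℕ) → (∀ i → f i ≡ lo + i) →
    length (filter P? (applyUpTo f n)) ≡ countFrom lo n
  length-filter-applyUpTo zero f _ = refl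
  length-filter-applyUpTo (suc n) {lo} f f≗ rewrite trans (f≗ 0) (+-identityʳ lo) with P? lo
  ... | yes _ = cong suc (length-filter-applyUpTo n (f ∘ suc) λ i → trans (f≗ (suc i)) (+-suc lo i))
  ... | no _ = length-filter-applyUpTo n (f ∘ suc) λ i → trans (f≗ (suc i)) (+-suc lo i)

  length-filter-range : ∀ n → length (filter P? (range n)) ≡ countFrom 1 n
  length-filter-range n =
    trans (cong (length ∘ filter P?) (map-upTo suc n)) (length-filter-applyUpTo n suc λ _ → refl)

[m+s]∸i<m∸q⇔q+s<i : ∀ {m s q i} → q ≤ m → i ≤ m + s → (m + s ∸ i < m ∸ q) ⇔ (q + s < i)
[m+s]∸i<m∸q⇔q+s<i {m} {s} {q} {i} q≤m i≤m+s = mk⇔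
  (λ lt → subst (_< i) (+-comm s q)
    (+-cancelˡ-< m _ _ (subst₂ _<_ left right (+-monoˡ-< (i + q) lt))))
  (λ lt → +-cancelʳ-< (i + q) _ _
    (subst₂ _<_ (sym left) (sym right) (+-monoʳ-< m (subst (_< i) (+-comm q s) lt))))
  where
  left : m + s ∸ i + (i + q) ≡ m + (s + q)
  left = begin
    m + s ∸ i + (i + q)   ≡⟨ sym (+-assoc (m + s ∸ i) i q) ⟩
    (m + s ∸ i + i) + q   ≡⟨ cong (_+ q) (m∸n+n≡m i≤m+s) ⟩
    m + s + q             ≡⟨ +-assoc m s q ⟩
    m + (s + q)           ∎
  right : m ∸ q + (i + q) ≡ m + i
  right = begin
    m ∸ q + (i + q)   ≡⟨ cong (λ x → m ∸ q + x) (+-comm i q) ⟩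
    m ∸ q + (q + i)   ≡⟨ sym (+-assoc (m ∸ q) q i) ⟩
    (m ∸ q + q) + i   ≡⟨ cong (_+ i) (m∸n+n≡m q≤m) ⟩
    m + i             ∎

0⊔[m-n]≡m∸n : ∀ m n → + 0 ⊔ (+ m - + n) ≡ + (m ∸ n)
0⊔[m-n]≡m∸n m n with n ≤? m
... | yes n≤m = begin
  + 0 ⊔ (+ m - + n)   ≡⟨ cong (λ x → + 0 ⊔ x) (trans (ℤₚ.m-n≡m⊖n m n) (ℤₚ.⊖-≥ n≤m)) ⟩
  + 0 ⊔ + (m ∸ n)     ≡⟨ ℤₚ.i≤j⇒i⊔j≡j (ℤ.+≤+ z≤n) ⟩
  + (m ∸ n)           ∎
... | no n≰m = begin
  + 0 ⊔ (+ m - + n)       ≡⟨ cong (λ x → + 0 ⊔ x) (trans (ℤₚ.m-n≡m⊖n m n) (ℤₚ.⊖-≰ n≰m)) ⟩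
  + 0 ⊔ ℤ.- + (n ∸ m)     ≡⟨ ℤₚ.i≥j⇒i⊔j≡i ℤₚ.neg-≤-pos ⟩
  + 0                     ≡⟨ cong +_ (sym (m≤n⇒m∸n≡0 (≰⇒≥ n≰m))) ⟩
  + (m ∸ n)               ∎

d-[m+s]+m-1≡d-[1+s] : ∀ (d m s : ℤ) → d - (m ℤ.+ s) ℤ.+ m - ℤ.1ℤ ≡ d - (ℤ.1ℤ ℤ.+ s)
d-[m+s]+m-1≡d-[1+s] = ℤ-Solver.solve-∀

a+[kg+e]≡[1+a+kd+e-kd-1]+kg : ∀ (a k g e kd : ℤ) →
  a ℤ.+ (k ℤ.* g ℤ.+ e) ≡ (ℤ.1ℤ ℤ.+ a ℤ.+ kd ℤ.+ e - kd - ℤ.1ℤ) ℤ.+ k ℤ.* g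
a+[kg+e]≡[1+a+kd+e-kd-1]+kg = ℤ-Solver.solve-∀

x+[1+s+e]≡1+[x+e+s] : ∀ x s e → x + (suc s + e) ≡ suc (x + e + s)
x+[1+s+e]≡1+[x+e+s] = ℕ-Solver.solve-∀

1+a+x+e+s≡a+[x+[1+s+e]] : ∀ a′ x s e → suc a′ + x + e + s ≡ a′ + (x + (suc s + e))
1+a+x+e+s≡a+[x+[1+s+e]] = ℕ-Solver.solve-∀

-- The hypotheses 1 ≤ a, a + k d ≤ m ≤ l are built in: a = 1 + a′, m = a + k d + e, l = m + s.
module CardI (a′ k d s e : ℕ) where

  a m l : ℕ
  a = suc a′
  m = a + k * d + e
  l = m + s

  hole : ℕ → ℕ
  hole j = a + j * d

  gap : ℕ
  gap = d ∸ suc s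

  open Counting (InI? a m k d l)

  a≤hole : ∀ j → a ≤ hole j
  a≤hole j = m≤m+n a (j * d)

  hole-mono : ∀ {j j′} → j ≤ j′ → hole j ≤ hole j′
  hole-mono j≤j′ = +-monoʳ-≤ a (*-monoˡ-≤ d j≤j′)

  hole≤m : ∀ {j} → j ≤ k → hole j ≤ m
  hole≤m j≤k = ≤-trans (hole-mono j≤k) (m≤m+n (hole k) e)

  hole-suc : ∀ j → hole j + d ≡ hole (suc j)
  hole-suc j = trans (+-assoc a (j * d) d) (cong (_+_ a) (+-comm (j * d) d))

  shadow⇔ : ∀ {i j} → j ≤ k → i ≤ l → (l ∸ i < m ∸ hole j) ⇔ (hole j + s < i)
  shadow⇔ j≤k i≤l = [m+s]∸i<m∸q⇔q+s<i (hole≤m j≤k) i≤l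

  InI-initial : ∀ {i} → 1 ≤ i → i ≤ a′ → InI a m k d l i
  InI-initial 1≤i i≤a′ = inj₁ (1≤i , i≤a′)

  ¬initial : ∀ {i} → a ≤ i → ¬ (1 ≤ i × i ≤ a ∸ 1)
  ¬initial a≤i (_ , i≤a′) = <⇒≱ a≤i i≤a′

  ¬InI-shadow : ∀ {i j} → j ≤ k → hole j ≤ i → i ≤ hole j + s → ¬ InI a m k d l i
  ¬InI-shadow {j = j} _ hj≤i _ (inj₁ initial) = ¬initial (≤-trans (a≤hole j) hj≤i) initial
  ¬InI-shadow {i} {j} j≤k hj≤i i≤hj+s (inj₂ (missesHoles , clear)) with m≤n⇒m<n∨m≡n hj≤i
  ... | inj₂ refl = missesHoles j j≤k refl
  ... | inj₁ hj<i = <⇒≱ (Equivalence.to (shadow⇔ j≤k i≤l) (clear j j≤k hj<i)) i≤hj+s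
    where
    i≤l : i ≤ l
    i≤l = ≤-trans i≤hj+s (+-monoˡ-≤ s (hole≤m j≤k))

  InI-beyond : ∀ {i j} → j ≤ k → hole j + s < i → i ≤ l →
    (∀ {j′} → j′ ≤ k → j < j′ → i < hole j′) → InI a m k d l i
  InI-beyond {i} {j} j≤k hj+s<i i≤l below = inj₂ (missesHoles , clear)
    where
    missesHoles : All≤ k λ j′ → ¬ (i ≡ hole j′)
    missesHoles j′ j′≤k with j′ ≤? j
    ... | yes j′≤j = >⇒≢ (≤-<-trans (hole-mono j′≤j) (≤-<-trans (m≤m+n (hole j) s) hj+s<i))
    ... | no j′≰j = <⇒≢ (below j′≤k (≰⇒> j′≰j))
    clear : All≤ k λ j′ → hole j′ < i → l ∸ i < m ∸ hole j′
    clear j′ j′≤k hj′<i with j′ ≤? j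
    ... | yes j′≤j =
      Equivalence.from (shadow⇔ j′≤k i≤l) (≤-<-trans (+-monoˡ-≤ s (hole-mono j′≤j)) hj+s<i)
    ... | no j′≰j = contradiction (below j′≤k (≰⇒> j′≰j)) (<⇒≯ hj′<i)

  countFrom-hole : ∀ {j} → j ≤ k → ∀ n →
    (∀ {i} → i < hole j + n → i ≤ l × (∀ {j′} → j′ ≤ k → j < j′ → i < hole j′)) →
    countFrom (hole j) n ≡ n ∸ suc s
  countFrom-hole {j} j≤k n beyond = countFrom-threshold (hole j) (suc s) n shadowed unshadowed
    where
    shadowed : ∀ {i} → hole j ≤ i → i < hole j + suc s → ¬ InI a m k d l i
    shadowed {i} hj≤i i< = ¬InI-shadow j≤k hj≤i (m<1+n⇒m≤n (subst (i <_) (+-suc (hole j) s) i<))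
    unshadowed : ∀ {i} → hole j + suc s ≤ i → i < hole j + n → InI a m k d l i
    unshadowed {i} ≤i i< = let (i≤l , below) = beyond i< in
      InI-beyond j≤k (subst (_≤ i) (+-suc (hole j) s) ≤i) i≤l below

  countFrom-gap : ∀ {j} → j < k → countFrom (hole j) d ≡ gap
  countFrom-gap {j} j<k = countFrom-hole (<⇒≤ j<k) d λ {i} i< →
    let i<next = subst (i <_) (hole-suc j) i< in
    ≤-trans (<⇒≤ i<next) (≤-trans (hole≤m j<k) (m≤m+n m s)) ,
    λ _ j<j′ → <-≤-trans i<next (hole-mono j<j′)

  countFrom-last : countFrom (hole k) (suc s + e) ≡ e
  countFrom-last = trans
    (countFrom-hole ≤-refl (suc s + e) λ {i} i< →
      m<1+n⇒m≤n (subst (i <_) (x+[1+s+e]≡1+[x+e+s] (hole k) s e) i<) ,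
      λ j′≤k k<j′ → contradiction j′≤k (<⇒≱ k<j′))
    (m+n∸m≡n (suc s) e)

  countFrom-holes : ∀ t {j} → t + j ≡ k →
    countFrom (hole j) (t * d + (suc s + e)) ≡ t * gap + e
  countFrom-holes zero refl = countFrom-last
  countFrom-holes (suc t) {j} t+j≡k = begin
    countFrom (hole j) ((d + t * d) + rest)
      ≡⟨ cong (countFrom (hole j)) (+-assoc d (t * d) rest) ⟩
    countFrom (hole j) (d + (t * d + rest))
      ≡⟨ countFrom-+ (hole j) d (t * d + rest) ⟩
    countFrom (hole j) d + countFrom (hole j + d) (t * d + rest)
      ≡⟨ cong₂ _+_ (countFrom-gap j<k) (cong (λ h → countFrom h (t * d + rest)) (hole-suc j)) ⟩
    gap + countFrom (hole (suc j)) (t * d + rest)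
      ≡⟨ cong (_+_ gap) (countFrom-holes t (trans (+-suc t j) t+j≡k)) ⟩
    gap + (t * gap + e)
      ≡⟨ sym (+-assoc gap (t * gap) e) ⟩
    suc t * gap + e ∎
    where
    rest : ℕ
    rest = suc s + e
    j<k : j < k
    j<k = subst (j <_) t+j≡k (s≤s (m≤n+m j t))

  cardI≡ : cardI a m k d l ≡ a′ + (k * gap + e)
  cardI≡ = begin
    cardI a m k d l
      ≡⟨ length-filter-range l ⟩
    countFrom 1 l
      ≡⟨ cong (countFrom 1) (1+a+x+e+s≡a+[x+[1+s+e]] a′ (k * d) s e) ⟩
    countFrom 1 (a′ + (k * d + (suc s + e)))
      ≡⟨ countFrom-+ 1 a′ (k * d + (suc s + e)) ⟩
    countFrom 1 a′ + countFrom a (k * d + (suc s + e))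
      ≡⟨ cong₂ _+_ (countFrom-all 1 a′ λ 1≤i i<a → InI-initial 1≤i (m<1+n⇒m≤n i<a))
                   (cong (λ h → countFrom h (k * d + (suc s + e))) (sym (+-identityʳ a))) ⟩
    a′ + countFrom (hole 0) (k * d + (suc s + e))
      ≡⟨ cong (_+_ a′) (countFrom-holes k (+-identityʳ k)) ⟩
    a′ + (k * gap + e) ∎

  gap-ℤ : + 0 ⊔ (+ d - + l ℤ.+ + m - + 1) ≡ + gap
  gap-ℤ = begin
    + 0 ⊔ (+ d - + (m + s) ℤ.+ + m - + 1)
      ≡⟨ cong (λ x → + 0 ⊔ (+ d - x ℤ.+ + m - + 1)) (ℤₚ.pos-+ m s) ⟩
    + 0 ⊔ (+ d - (+ m ℤ.+ + s) ℤ.+ + m - + 1)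
      ≡⟨ cong (λ x → + 0 ⊔ x) (d-[m+s]+m-1≡d-[1+s] (+ d) (+ m) (+ s)) ⟩
    + 0 ⊔ (+ d - (+ 1 ℤ.+ + s))
      ≡⟨ cong (λ x → + 0 ⊔ (+ d - x)) (sym (ℤₚ.pos-+ 1 s)) ⟩
    + 0 ⊔ (+ d - + suc s)
      ≡⟨ 0⊔[m-n]≡m∸n d (suc s) ⟩
    + gap ∎

  cardI-ℤ : + cardI a m k d l ≡ (+ m - + (k * d) - + 1) ℤ.+ + k ℤ.* + gap
  cardI-ℤ = begin
    + cardI a m k d l
      ≡⟨ cong +_ cardI≡ ⟩
    + (a′ + (k * gap + e))
      ≡⟨ ℤₚ.pos-+ a′ (k * gap + e) ⟩
    + a′ ℤ.+ + (k * gap + e)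
      ≡⟨ cong (ℤ._+_ (+ a′)) (ℤₚ.pos-+ (k * gap) e) ⟩
    + a′ ℤ.+ (+ (k * gap) ℤ.+ + e)
      ≡⟨ cong (λ x → + a′ ℤ.+ (x ℤ.+ + e)) (ℤₚ.pos-* k gap) ⟩
    + a′ ℤ.+ (+ k ℤ.* + gap ℤ.+ + e)
      ≡⟨ a+[kg+e]≡[1+a+kd+e-kd-1]+kg (+ a′) (+ k) (+ gap) (+ e) (+ (k * d)) ⟩
    (ℤ.1ℤ ℤ.+ + a′ ℤ.+ + (k * d) ℤ.+ + e - + (k * d) - + 1) ℤ.+ + k ℤ.* + gap
      ≡⟨ cong (λ x → (x - + (k * d) - + 1) ℤ.+ + k ℤ.* + gap) (sym pos-m) ⟩
    (+ m - + (k * d) - + 1) ℤ.+ + k ℤ.* + gap ∎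
    where
    pos-m : + m ≡ ℤ.1ℤ ℤ.+ + a′ ℤ.+ + (k * d) ℤ.+ + e
    pos-m = trans (ℤₚ.pos-+ (a + k * d) e)
      (cong (ℤ._+ + e) (trans (ℤₚ.pos-+ a (k * d)) (cong (ℤ._+ + (k * d)) (ℤₚ.pos-+ 1 a′))))

theorem4 : (a m k d l : ℕ) → 1 ≤ a → 1 ≤ m → a + k * d ≤ m → m ≤ l →
    + cardI a m k d l
    ≡ (+ m - + (k * d) - + 1) Data.Integer.+ (+ k) Data.Integer.* (+ 0 ⊔ (+ d - + l Data.Integer.+ + m - + 1))
theorem4 (suc a′) m k d l (s≤s z≤n) _ a+kd≤m m≤l
  with e , refl ← m≤n⇒∃[o]m+o≡n a+kd≤m
  with s , refl ← m≤n⇒∃[o]m+o≡n m≤l =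
  trans cardI-ℤ (cong (λ x → (+ m - + (k * d) - + 1) ℤ.+ + k ℤ.* x) (sym gap-ℤ))
  where open CardI a′ k d s e using (cardI-ℤ; gap-ℤ)
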